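{- For every integer $n\geq 2$, the $n$-book graph $B_n$ satisfies $\chi_D(B_n)\leq \lceil\sqrt{n}\,\rceil+2$.
   Context: The $n$-book graph $B_n$ ($n\geq 2$) is the Cartesian product of the star $K_{1,n}$ and the path $P_2$ on two vertices; concretely it has vertices $v_0,w_0,v_1,w_1,\dots,v_n,w_n$ and edges $v_0w_0$, $v_0v_i$, $w_0w_i$, $v_iw_i$ for $1\leq i\leq n$. A vertex coloring is distinguishing if the only automorphism preserving all vertex colors is the identity. The distinguishing chromatic number $\chi_D(G)$ is the minimum $r$ such that $G$ has a proper distinguishing coloring with $r$ colors. -}

module Defs where

open import Data.Nat using (ℕ; zero; suc; _*_; _∸_; _<_; _≤_)
open import Data.Fin using (Fin)
open import Data.Product using (_×_; _,_; ∃-syntax)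
open import Data.Sum using (_⊎_)
open import Relation.Binary.PropositionalEquality using (_≡_; _≢_)
open import Relation.Nullary using (¬_)

record Automorphism (V : Set) (Adj : V → V → Set) : Set where
  field
    to       : V → V
    from     : V → V
    to-from  : ∀ x → to (from x) ≡ x
    from-to  : ∀ x → from (to x) ≡ x
    adj-pres : ∀ x y → Adj x y → Adj (to x) (to y)
    adj-refl : ∀ x y → Adj (to x) (to y) → Adj x y
open Automorphism public

Proper : {V : Set} (Adj : V → V → Set) {r : ℕ} → (V → Fin r) → Set
Proper {V} Adj c = ∀ (x y : V) → Adj x y → c x ≢ c y

Distinguishing : {V : Set} (Adj : V → V → Set) {r : ℕ} → (V → Fin r) → Set
Distinguishing {V} Adj c =
  ∀ (σ : Automorphism V Adj) → (∀ x → c (to σ x) ≡ c x) → ∀ x → to σ x ≡ x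

χD≤ : (V : Set) (Adj : V → V → Set) → ℕ → Set
χD≤ V Adj k = ∃[ r ] (r ≤ k × ∃[ c ] (Proper Adj {r} c × Distinguishing Adj {r} c))

-- The n-book graph B_n = K_{1,n} □ P_2.
-- Vertex (0 , i) is v_i, vertex (1 , i) is w_i, for i ∈ {0,…,n}; index 0 is the centre.
BookV : ℕ → Set
BookV n = Fin 2 × Fin (suc n)

BookAdj : (n : ℕ) → BookV n → BookV n → Set
BookAdj n (a , i) (b , j) =
    (a ≡ b × ((i ≡ Fin.zero × j ≢ Fin.zero) ⊎ (i ≢ Fin.zero × j ≡ Fin.zero)))
  ⊎ (a ≢ b × i ≡ j)

IsCeilSqrt : ℕ → ℕ → Set
IsCeilSqrt n s = n ≤ s * s × (∀ t → n ≤ t * t → s ≤ t)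

{-# OPTIONS --safe #-}
-- Since n ≤ s², the pages can be placed injectively in an s × s grid by k ↦ (k / s , k % s).
-- Colour v₀ with s, w₀ with s + 1, and the page (q , r) with q on vₖ and r on wₖ, except
-- that wₖ gets s when r = q, to keep the rung proper.  Then w₀ is the only vertex of its
-- colour, so a colour-preserving automorphism fixes w₀, hence v₀ (as n ≥ 2), hence maps
-- pages to pages; distinct pages carry distinct colour pairs, so every page is fixed.
module Submission where

open import Defs
open import Data.Nat using (ℕ; _≤_; _+_; zero; suc; _<_; _*_; NonZero; _≟_; z≤n; s≤s)
open import Data.Nat.Properties
  using (≤-refl; <-≤-trans; ≤-trans; <⇒≤; <⇒≢; >⇒≢; ≤⇒≯; n<1+n; n≤1+n; +-comm)
open import Data.Nat.DivMod using (_/_; _%_; m%n<n; m≡m%n+[m/n]*n; m<n*o⇒m/o<n)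
open import Data.Fin as Fin using (Fin; toℕ; fromℕ<)
open import Data.Fin.Patterns using (0F; 1F)
open import Data.Fin.Properties using (toℕ-injective; toℕ<n; fromℕ<-injective)
open import Data.Product using (_×_; _,_; ∃-syntax; proj₁; proj₂)
open import Data.Sum using (_⊎_; inj₁; inj₂)
open import Data.Empty using (⊥-elim)
open import Function using (_∘_)
open import Relation.Nullary using (yes; no; contradiction)
open import Relation.Binary.PropositionalEquality

χD≤-fromℕ : {V : Set} {Adj : V → V → Set} (k : ℕ) (c : V → ℕ) → (∀ x → c x < k) →
            (∀ x y → Adj x y → c x ≢ c y) →
            (∀ (σ : Automorphism V Adj) → (∀ x → c (to σ x) ≡ c x) → ∀ x → to σ x ≡ x) →
            χD≤ V Adj k
χD≤-fromℕ {V} k c c<k proper distinguishing =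
  k , ≤-refl , c′ , (λ x y xy → proper x y xy ∘ c′-injective) ,
  (λ σ pres → distinguishing σ (c′-injective ∘ pres))
  where
  c′ : V → Fin k
  c′ x = fromℕ< (c<k x)

  c′-injective : ∀ {x y} → c′ x ≡ c′ y → c x ≡ c y
  c′-injective {x} {y} = fromℕ<-injective (c x) (c y) (c<k x) (c<k y)

-- The paper's vₖ₊₁ and wₖ₊₁ are v k and w k, for k : Fin n.
pattern v₀ = (0F , 0F)
pattern w₀ = (1F , 0F)
pattern v k = (0F , Fin.suc k)
pattern w k = (1F , Fin.suc k)

module _ {n : ℕ} where

  data Edge : BookV n → BookV n → Set where
    spoke  : ∀ a k → Edge (a , 0F) (a , Fin.suc k)
    spoke′ : ∀ a k → Edge (a , Fin.suc k) (a , 0F)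
    rung   : ∀ i → Edge (0F , i) (1F , i)
    rung′  : ∀ i → Edge (1F , i) (0F , i)

  fromEdge : ∀ {x y} → Edge x y → BookAdj n x y
  fromEdge (spoke a k)  = inj₁ (refl , inj₁ (refl , λ ()))
  fromEdge (spoke′ a k) = inj₁ (refl , inj₂ ((λ ()) , refl))
  fromEdge (rung i)     = inj₂ ((λ ()) , refl)
  fromEdge (rung′ i)    = inj₂ ((λ ()) , refl)

  toEdge : ∀ x y → BookAdj n x y → Edge x y
  toEdge (a , 0F)        (.a , 0F)        (inj₁ (refl , inj₁ (_ , 0≢0))) = ⊥-elim (0≢0 refl)
  toEdge (a , 0F)        (.a , 0F)        (inj₁ (refl , inj₂ (0≢0 , _))) = ⊥-elim (0≢0 refl)
  toEdge (a , 0F)        (.a , Fin.suc k) (inj₁ (refl , _))              = spoke a k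
  toEdge (a , Fin.suc k) (.a , 0F)        (inj₁ (refl , _))              = spoke′ a k
  toEdge (a , Fin.suc i) (.a , Fin.suc j) (inj₁ (refl , inj₁ (() , _)))
  toEdge (a , Fin.suc i) (.a , Fin.suc j) (inj₁ (refl , inj₂ (_ , ())))
  toEdge (0F , i)        (0F , .i)        (inj₂ (a≢a , refl))            = ⊥-elim (a≢a refl)
  toEdge (0F , i)        (1F , .i)        (inj₂ (_ , refl))              = rung i
  toEdge (1F , i)        (0F , .i)        (inj₂ (_ , refl))              = rung′ i
  toEdge (1F , i)        (1F , .i)        (inj₂ (a≢a , refl))            = ⊥-elim (a≢a refl)

  neighbour-of-v₀ : ∀ x → BookAdj n x v₀ → x ≡ w₀ ⊎ ∃[ k ] x ≡ v k
  neighbour-of-v₀ x x~v₀ with toEdge x v₀ x~v₀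
  ... | spoke′ _ k = inj₂ (k , refl)
  ... | rung′ _    = inj₁ refl

  neighbour-of-w₀ : ∀ x → BookAdj n x w₀ → x ≡ v₀ ⊎ ∃[ k ] x ≡ w k
  neighbour-of-w₀ x x~w₀ with toEdge x w₀ x~w₀
  ... | spoke′ _ k = inj₂ (k , refl)
  ... | rung _     = inj₁ refl

  neighbour-of-w : ∀ x k → BookAdj n x (w k) → x ≡ w₀ ⊎ x ≡ v k
  neighbour-of-w x k x~wₖ with toEdge x (w k) x~wₖ
  ... | spoke _ _ = inj₁ refl
  ... | rung _    = inj₂ refl

  v~w⇒same-page : ∀ j k → BookAdj n (v j) (w k) → j ≡ k
  v~w⇒same-page j k vⱼ~wₖ with toEdge (v j) (w k) vⱼ~wₖ
  ... | rung _ = refl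

  module _ (σ : Automorphism (BookV n) (BookAdj n)) where

    to-injective : ∀ {x y} → to σ x ≡ to σ y → x ≡ y
    to-injective {x} {y} σx≡σy = begin
      x                ≡⟨ from-to σ x ⟨
      from σ (to σ x)  ≡⟨ cong (from σ) σx≡σy ⟩
      from σ (to σ y)  ≡⟨ from-to σ y ⟩
      y                ∎
      where open ≡-Reasoning

    image-of-neighbour : ∀ {x y z} → BookAdj n x y → to σ y ≡ z → BookAdj n (to σ x) z
    image-of-neighbour {x} {y} x~y refl = adj-pres σ x y x~y

    preimage-of-fixed : ∀ {x y} → to σ y ≡ y → to σ x ≡ y → x ≡ y
    preimage-of-fixed σy≡y σx≡y = to-injective (trans σx≡y (sym σy≡y))

    -- If σ v₀ were a page vertex wₖ, all n ≥ 2 vertices vⱼ would be sent to its only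
    -- neighbour vₖ other than w₀.
    fix-w₀⇒fix-v₀ : 2 ≤ n → to σ w₀ ≡ w₀ → to σ v₀ ≡ v₀
    fix-w₀⇒fix-v₀ (s≤s (s≤s z≤n)) σw₀≡w₀
      with neighbour-of-w₀ (to σ v₀) (image-of-neighbour (fromEdge (rung 0F)) σw₀≡w₀)
    ... | inj₁ σv₀≡v₀     = σv₀≡v₀
    ... | inj₂ (k , σv₀≡wₖ) =
      ⊥-elim (v₁≢v₂ (to-injective (trans (σv≡vₖ 0F) (sym (σv≡vₖ 1F)))))
      where
      v₁≢v₂ : v 0F ≢ v 1F
      v₁≢v₂ ()

      σv≡vₖ : ∀ j → to σ (v j) ≡ v k
      σv≡vₖ j with neighbour-of-w (to σ (v j)) k (image-of-neighbour (fromEdge (spoke′ 0F j)) σv₀≡wₖ)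
      ... | inj₁ σvⱼ≡w₀ = contradiction (preimage-of-fixed σw₀≡w₀ σvⱼ≡w₀) λ ()
      ... | inj₂ σvⱼ≡vₖ = σvⱼ≡vₖ

    fix-hubs⇒pages-to-pages : to σ v₀ ≡ v₀ → to σ w₀ ≡ w₀ →
                              ∀ k → ∃[ k′ ] (to σ (v k) ≡ v k′ × to σ (w k) ≡ w k′)
    fix-hubs⇒pages-to-pages σv₀≡v₀ σw₀≡w₀ k
      with neighbour-of-v₀ (to σ (v k)) (image-of-neighbour (fromEdge (spoke′ 0F k)) σv₀≡v₀)
         | neighbour-of-w₀ (to σ (w k)) (image-of-neighbour (fromEdge (spoke′ 1F k)) σw₀≡w₀)
    ... | inj₁ σvₖ≡w₀ | _ = contradiction (preimage-of-fixed σw₀≡w₀ σvₖ≡w₀) λ ()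
    ... | _ | inj₁ σwₖ≡v₀ = contradiction (preimage-of-fixed σv₀≡v₀ σwₖ≡v₀) λ ()
    ... | inj₂ (j , σvₖ≡vⱼ) | inj₂ (j′ , σwₖ≡wⱼ′)
      with refl ← v~w⇒same-page j j′
                    (subst₂ (BookAdj n) σvₖ≡vⱼ σwₖ≡wⱼ′ (adj-pres σ _ _ (fromEdge (rung (Fin.suc k)))))
      = j , σvₖ≡vⱼ , σwₖ≡wⱼ′

  book-distinguishing : {C : Set} → 2 ≤ n → (c : BookV n → C) →
                        (∀ x → c x ≡ c w₀ → x ≡ w₀) →
                        (∀ j k → c (v j) ≡ c (v k) → c (w j) ≡ c (w k) → j ≡ k) →
                        ∀ (σ : Automorphism (BookV n) (BookAdj n)) → (∀ x → c (to σ x) ≡ c x) →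
                        ∀ x → to σ x ≡ x
  book-distinguishing 2≤n c w₀-unique pages-distinct σ pres = fixed
    where
    σw₀≡w₀ : to σ w₀ ≡ w₀
    σw₀≡w₀ = w₀-unique (to σ w₀) (pres w₀)

    σv₀≡v₀ : to σ v₀ ≡ v₀
    σv₀≡v₀ = fix-w₀⇒fix-v₀ σ 2≤n σw₀≡w₀

    page-fixed : ∀ k → to σ (v k) ≡ v k × to σ (w k) ≡ w k
    page-fixed k with fix-hubs⇒pages-to-pages σ σv₀≡v₀ σw₀≡w₀ k
    ... | k′ , σvₖ≡vₖ′ , σwₖ≡wₖ′
      with refl ← pages-distinct k′ k (trans (cong c (sym σvₖ≡vₖ′)) (pres (v k)))
                                      (trans (cong c (sym σwₖ≡wₖ′)) (pres (w k)))
      = σvₖ≡vₖ′ , σwₖ≡wₖ′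

    fixed : ∀ x → to σ x ≡ x
    fixed v₀    = σv₀≡v₀
    fixed w₀    = σw₀≡w₀
    fixed (v k) = proj₁ (page-fixed k)
    fixed (w k) = proj₂ (page-fixed k)

module Colouring (n s : ℕ) {{_ : NonZero s}} (n≤s*s : n ≤ s * s) where

  avoid : ℕ → ℕ → ℕ
  avoid q r with q ≟ r
  ... | yes _ = s
  ... | no _  = r

  avoid-≤ : ∀ q {r} → r < s → avoid q r ≤ s
  avoid-≤ q {r} r<s with q ≟ r
  ... | yes _ = ≤-refl
  ... | no _  = <⇒≤ r<s

  avoid-≢ : ∀ {q} r → q < s → avoid q r ≢ q
  avoid-≢ {q} r q<s with q ≟ r
  ... | yes _   = >⇒≢ q<s
  ... | no q≢r  = q≢r ∘ sym

  avoid-injective : ∀ q {r r′} → r < s → r′ < s → avoid q r ≡ avoid q r′ → r ≡ r′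
  avoid-injective q {r} {r′} r<s r′<s eq with q ≟ r | q ≟ r′
  ... | yes q≡r | yes q≡r′ = trans (sym q≡r) q≡r′
  ... | yes _   | no _     = ⊥-elim (>⇒≢ r′<s eq)
  ... | no _    | yes _    = ⊥-elim (<⇒≢ r<s eq)
  ... | no _    | no _     = eq

  quotient remainder : Fin n → ℕ
  quotient k  = toℕ k / s
  remainder k = toℕ k % s

  quotient<s : ∀ k → quotient k < s
  quotient<s k = m<n*o⇒m/o<n (<-≤-trans (toℕ<n k) n≤s*s)

  remainder<s : ∀ k → remainder k < s
  remainder<s k = m%n<n (toℕ k) s

  colour : BookV n → ℕ
  colour v₀    = s
  colour w₀    = suc s
  colour (v k) = quotient k
  colour (w k) = avoid (quotient k) (remainder k)

  colour-≤ : ∀ x → colour x ≤ suc s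
  colour-≤ v₀    = n≤1+n s
  colour-≤ w₀    = ≤-refl
  colour-≤ (v k) = ≤-trans (<⇒≤ (quotient<s k)) (n≤1+n s)
  colour-≤ (w k) = ≤-trans (avoid-≤ (quotient k) (remainder<s k)) (n≤1+n s)

  colour-< : ∀ x → colour x < s + 2
  colour-< x = subst (colour x <_) (+-comm 2 s) (s≤s (colour-≤ x))

  spoke-colours-differ : ∀ a k → colour (a , 0F) ≢ colour (a , Fin.suc k)
  spoke-colours-differ 0F k = >⇒≢ (quotient<s k)
  spoke-colours-differ 1F k = >⇒≢ (s≤s (avoid-≤ (quotient k) (remainder<s k)))

  rung-colours-differ : ∀ i → colour (0F , i) ≢ colour (1F , i)
  rung-colours-differ 0F          = <⇒≢ (n<1+n s)
  rung-colours-differ (Fin.suc k) = avoid-≢ (remainder k) (quotient<s k) ∘ sym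

  colour-proper : ∀ x y → BookAdj n x y → colour x ≢ colour y
  colour-proper x y x~y with toEdge x y x~y
  ... | spoke a k  = spoke-colours-differ a k
  ... | spoke′ a k = spoke-colours-differ a k ∘ sym
  ... | rung i     = rung-colours-differ i
  ... | rung′ i    = rung-colours-differ i ∘ sym

  colour-w₀-unique : ∀ x → colour x ≡ colour w₀ → x ≡ w₀
  colour-w₀-unique v₀    eq = ⊥-elim (<⇒≢ (n<1+n s) eq)
  colour-w₀-unique w₀    eq = refl
  colour-w₀-unique (v k) eq = ⊥-elim (<⇒≢ (≤-trans (quotient<s k) (n≤1+n s)) eq)
  colour-w₀-unique (w k) eq = ⊥-elim (<⇒≢ (s≤s (avoid-≤ (quotient k) (remainder<s k))) eq)

  page-colours-injective : ∀ j k → colour (v j) ≡ colour (v k) → colour (w j) ≡ colour (w k) →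
                           j ≡ k
  page-colours-injective j k qⱼ≡qₖ wⱼ≡wₖ = toℕ-injective (begin
    toℕ j                         ≡⟨ m≡m%n+[m/n]*n (toℕ j) s ⟩
    remainder j + quotient j * s  ≡⟨ cong₂ (λ r q → r + q * s) rⱼ≡rₖ qⱼ≡qₖ ⟩
    remainder k + quotient k * s  ≡⟨ m≡m%n+[m/n]*n (toℕ k) s ⟨
    toℕ k                         ∎)
    where
    open ≡-Reasoning
    rⱼ≡rₖ : remainder j ≡ remainder k
    rⱼ≡rₖ = avoid-injective (quotient k) (remainder<s j) (remainder<s k)
              (trans (cong (λ q → avoid q (remainder j)) (sym qⱼ≡qₖ)) wⱼ≡wₖ)

χD≤-book : ∀ n s → 2 ≤ n → n ≤ s * s → χD≤ (BookV n) (BookAdj n) (s + 2)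
χD≤-book n zero      2≤n n≤0   = ⊥-elim (≤⇒≯ n≤0 (≤-trans (s≤s z≤n) 2≤n))
χD≤-book n s@(suc _) 2≤n n≤s*s =
  χD≤-fromℕ (s + 2) colour colour-< colour-proper
    (book-distinguishing 2≤n colour colour-w₀-unique page-colours-injective)
  where open Colouring n s n≤s*s

lemma5p7 : (n : ℕ) → 2 ≤ n → (s : ℕ) → IsCeilSqrt n s → χD≤ (BookV n) (BookAdj n) (s + 2)
lemma5p7 n 2≤n s (n≤s*s , _) = χD≤-book n s 2≤n n≤s*s
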